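{- Let $k\geq 1$ and $\gamma\geq 1$ be integers. Every connected graph $G$ with $\gamma^r_k(G)=\gamma$ has order at most $\gamma+\gamma\sum_{p=1}^{k}(2p+1)^{\gamma-1}$. Moreover, for all $k,\gamma\geq 1$ there exists a connected graph $G$ with $\gamma^r_k(G)=\gamma$ and order exactly $\gamma+\gamma\sum_{p=1}^{k}(2p+1)^{\gamma-1}$.
   Context: For a graph $G=(V,E)$ and $k\geq 1$, a set $D\subseteq V$ is distance $k$-dominating if every $v\in V\setminus D$ is at distance at most $k$ from some vertex of $D$. An ordered set $W=\{w_1,\dots,w_r\}$ is a resolving set if for all distinct $u,v\in V\setminus W$ the distance vectors $(d_G(u,w_i))_i$ and $(d_G(v,w_i))_i$ differ. $\gamma^r_k(G)$ is the minimum cardinality of a set that is both resolving and distance $k$-dominating. -}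

module Defs where

open import Data.Nat using (ℕ; zero; suc; _+_; _*_; _∸_; _^_; _≤_; _<_)
open import Data.Fin using (Fin)
open import Data.Fin.Subset using (Subset; _∈_; _∉_; ∣_∣)
open import Data.Bool using (Bool; true; false)
open import Data.Product using (Σ; ∃; ∃-syntax; _×_; _,_)
open import Data.Sum using (_⊎_)
open import Relation.Nullary using (¬_)
open import Relation.Binary.PropositionalEquality using (_≡_; _≢_)

record Graph (n : ℕ) : Set where
  field
    adj   : Fin n → Fin n → Bool
    sym   : ∀ u v → adj u v ≡ adj v u
    irrefl : ∀ u → adj u u ≡ false

open Graph public

Reach : ∀ {n} → Graph n → ℕ → Fin n → Fin n → Set
Reach G zero    u v = u ≡ v
Reach G (suc d) u v = Reach G d u v ⊎ (∃[ w ] (adj G u w ≡ true × Reach G d w v))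

Dist : ∀ {n} → Graph n → Fin n → Fin n → ℕ → Set
Dist G u v d = Reach G d u v × (∀ d' → d' < d → ¬ Reach G d' u v)

Connected : ∀ {n} → Graph n → Set
Connected G = ∀ u v → ∃[ d ] Reach G d u v

Resolving : ∀ {n} → Graph n → Subset n → Set
Resolving {n} G W = ∀ (u v : Fin n) → u ∉ W → v ∉ W → u ≢ v →
  ∃[ w ] (w ∈ W × ∃[ d₁ ] ∃[ d₂ ] (Dist G u w d₁ × Dist G v w d₂ × d₁ ≢ d₂))

KDominating : ∀ {n} → Graph n → ℕ → Subset n → Set
KDominating {n} G k D = ∀ (v : Fin n) → v ∉ D → ∃[ w ] (w ∈ D × Reach G k v w)

GammaRK≡ : ∀ {n} → Graph n → ℕ → ℕ → Set
GammaRK≡ {n} G k γ =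
  (∃[ W ] (∣ W ∣ ≡ γ × Resolving G W × KDominating G k W)) ×
  (∀ (W : Subset n) → Resolving G W → KDominating G k W → γ ≤ ∣ W ∣)

sumPow : ℕ → ℕ → ℕ
sumPow γ zero    = 0
sumPow γ (suc p) = sumPow γ p + (2 * suc p + 1) ^ (γ ∸ 1)

bound : ℕ → ℕ → ℕ
bound k γ = γ + γ * sumPow γ k

-- A vertex v ∉ W
-- has some wᵢ at distance p ∈ [1, k], and by the triangle inequality every other d(v, wⱼ) lies
-- in the window [d(wᵢ, wⱼ) − p, d(wᵢ, wⱼ) + p], hence is recorded by an offset in [0, 2p].
-- Since W resolves, v is determined by (i, p, offsets), so there are at most
-- γ + γ Σₚ (2p+1)^(γ−1) vertices.
--
-- Sharpness: take all these labels as vertices, give each the distance vector it would have if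
-- the landmarks were pairwise at distance 2k+1, and join two vertices whose vectors differ by at
-- most 1 in every coordinate. Vectors change by at most 1 along an edge, and from every vertex
-- some neighbour is one step closer to any prescribed landmark, so the vectors are the true
-- distance vectors. Hence the landmarks resolve and k-dominate, and by the upper bound no
-- smaller set can.

module Submission where

open import Defs hiding (sym)
open import Data.Nat
  using (ℕ; zero; suc; pred; >-nonZero; _+_; _*_; _∸_; _^_; _⊔_; _⊓_; _≤_; _<_; _≤?_; _<?_; z≤n; s≤s; z<s)
open import Data.Nat.Properties
open import Data.Nat.Tactic.RingSolver using (solve-∀)
open import Data.Fin
  using (Fin; zero; suc; toℕ; combine; fromℕ<; punchIn; punchOut; funToFin; finToFun) renaming (_≟_ to _≟ᶠ_)
open import Data.Fin.Properties
  using (any?; all?; ¬∀⟶∃¬; ¬Fin0; 0↔⊥; +↔⊎; *↔×; injective⇒≤; toℕ-injective; toℕ-fromℕ<; toℕ<n;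
         punchIn-punchOut; punchOut-punchIn; punchOut-cong; punchInᵢ≢i;
         finToFun-funToFin; funToFin-finToFin)
open import Data.Fin.Subset
  using (Subset; _∈_; _∉_; ∣_∣; inside; outside) renaming (⊤ to full; ⊥ to empty)
open import Data.Fin.Subset.Properties using (_∈?_; ∣⊥∣≡0)
open import Data.Vec using ([]; _∷_; _++_; here; there)
open import Data.Vec.Properties using (lookup-++ˡ; lookup-replicate; lookup⇒[]=)
open import Data.Vec.Functional using (updateAt)
open import Data.Vec.Functional.Properties using (updateAt-updates; updateAt-minimal)
open import Data.Bool using (true)
open import Data.Bool.Properties using (T-≡) renaming (_≟_ to _≟ᵇ_)
open import Data.Product using (Σ; ∃; ∃-syntax; _×_; _,_; proj₁; proj₂)
open import Data.Sum using (_⊎_; inj₁; inj₂)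
open import Data.Sum.Properties using (inj₁-injective; inj₂-injective)
open import Data.Sum.Function.Propositional using (_⊎-↔_)
open import Data.Product.Function.NonDependent.Propositional using (_×-↔_)
open import Data.Empty using (⊥; ⊥-elim)
open import Function using (_∘_; const)
open import Function.Bundles using (_↔_; Inverse; Injection; Equivalence; mk⇔)
open import Function.Properties.Inverse using (↔-refl; ↔-sym; ↔-trans; ↔⇒↣)
open import Relation.Nullary using (Dec; yes; no; does; ¬?)
open import Relation.Nullary.Decidable
  using (_⊎-dec_; _×-dec_; dec-true; dec-false; does-⇔; isYes≗does; toWitness)
open import Relation.Binary.PropositionalEquality
  using (_≡_; _≢_; ≢-sym; _≗_; refl; sym; trans; cong; cong₂; subst; module ≡-Reasoning)

module Walks {n : ℕ} (G : Graph n) where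

  Reach-mono : ∀ {d e u v} → d ≤ e → Reach G d u v → Reach G e u v
  Reach-mono {zero}  {zero}  z≤n     r                  = r
  Reach-mono {zero}  {suc e} z≤n     r                  = inj₁ (Reach-mono {zero} {e} z≤n r)
  Reach-mono {suc d} {suc e} (s≤s h) (inj₁ r)           = inj₁ (Reach-mono h r)
  Reach-mono {suc d} {suc e} (s≤s h) (inj₂ (w , a , r)) = inj₂ (w , a , Reach-mono h r)

  Reach-trans : ∀ d {e u v w} → Reach G d u v → Reach G e v w → Reach G (d + e) u w
  Reach-trans zero    refl               s = s
  Reach-trans (suc d) (inj₁ r)           s = inj₁ (Reach-trans d r s)
  Reach-trans (suc d) (inj₂ (x , a , r)) s = inj₂ (x , a , Reach-trans d r s)

  Reach-snoc : ∀ d {u v w} → Reach G d u v → adj G v w ≡ true → Reach G (suc d) u w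
  Reach-snoc zero    refl               a = inj₂ (_ , a , refl)
  Reach-snoc (suc d) (inj₁ r)           a = inj₁ (Reach-snoc d r a)
  Reach-snoc (suc d) (inj₂ (x , a′ , r)) a = inj₂ (x , a′ , Reach-snoc d r a)

  Reach-sym : ∀ d {u v} → Reach G d u v → Reach G d v u
  Reach-sym zero    refl                   = refl
  Reach-sym (suc d) (inj₁ r)               = inj₁ (Reach-sym d r)
  Reach-sym (suc d) {u} (inj₂ (x , a , r)) = Reach-snoc d (Reach-sym d r) (trans (Graph.sym G x u) a)

  Reach? : ∀ d u v → Dec (Reach G d u v)
  Reach? zero    u v = u ≟ᶠ v
  Reach? (suc d) u v = Reach? d u v ⊎-dec any? (λ w → (adj G u w ≟ᵇ true) ×-dec Reach? d w v)

  Reach⇒Dist : ∀ d {u v} → Reach G d u v → ∃[ e ] Dist G u v e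
  Reach⇒Dist zero    r = 0 , r , λ _ ()
  Reach⇒Dist (suc d) {u} {v} r with Reach? d u v
  ... | yes r′ = Reach⇒Dist d r′
  ... | no ¬r  = suc d , r , λ e e<1+d r′ → ¬r (Reach-mono (≤-pred e<1+d) r′)

  Dist-≤ : ∀ {u v e d} → Dist G u v e → Reach G d u v → e ≤ d
  Dist-≤ (_ , least) r = ≮⇒≥ λ d<e → least _ d<e r

  Dist-unique : ∀ {u v e e′} → Dist G u v e → Dist G u v e′ → e ≡ e′
  Dist-unique D D′ = ≤-antisym (Dist-≤ D (proj₁ D′)) (Dist-≤ D′ (proj₁ D))

  Dist-sym : ∀ {u v e} → Dist G u v e → Dist G v u e
  Dist-sym {e = e} (r , least) = Reach-sym e r , λ d d<e r′ → least d d<e (Reach-sym d r′)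

module Distance {n : ℕ} (G : Graph n) (C : Connected G) where
  open Walks G

  dist : Fin n → Fin n → ℕ
  dist u v = proj₁ (Reach⇒Dist _ (proj₂ (C u v)))

  dist-Dist : ∀ u v → Dist G u v (dist u v)
  dist-Dist u v = proj₂ (Reach⇒Dist _ (proj₂ (C u v)))

  dist-Reach : ∀ u v → Reach G (dist u v) u v
  dist-Reach u v = proj₁ (dist-Dist u v)

  dist-≤ : ∀ {u v d} → Reach G d u v → dist u v ≤ d
  dist-≤ = Dist-≤ (dist-Dist _ _)

  dist-sym : ∀ u v → dist u v ≡ dist v u
  dist-sym u v = Dist-unique (Dist-sym (dist-Dist u v)) (dist-Dist v u)

  dist-triangle : ∀ u v w → dist u w ≤ dist u v + dist v w
  dist-triangle u v w = dist-≤ (Reach-trans (dist u v) (dist-Reach u v) (dist-Reach v w))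

  dist≡0⇒≡ : ∀ {u v} → dist u v ≡ 0 → u ≡ v
  dist≡0⇒≡ {u} {v} eq = subst (λ d → Reach G d u v) eq (dist-Reach u v)

m≤n⇒m<n+1 : ∀ {m n} → m ≤ n → m < n + 1
m≤n⇒m<n+1 {n = n} m≤n = ≤-<-trans m≤n (m<m+n n z<s)

m<n+1⇒m≤n : ∀ {m} n → m < n + 1 → m ≤ n
m<n+1⇒m≤n {m} n m<n+1 = m<1+n⇒m≤n (subst (m <_) (+-comm n 1) m<n+1)

∸-window : ∀ {a c} p → a ≤ c + p → a ∸ (c ∸ p) ≤ 2 * p
∸-window {a} {c} p a≤c+p = m≤n+o⇒m∸n≤o a (c ∸ p) (begin
  a                 ≤⟨ a≤c+p ⟩
  c + p             ≤⟨ +-monoˡ-≤ p (m≤n+m∸n c p) ⟩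
  p + (c ∸ p) + p   ≡⟨ rearrange p (c ∸ p) ⟩
  c ∸ p + 2 * p     ∎)
  where
  open ≤-Reasoning
  rearrange : ∀ p e → p + e + p ≡ e + 2 * p
  rearrange = solve-∀

infix 4 _≈₁_

_≈₁_ : ℕ → ℕ → Set
a ≈₁ b = a ≤ suc b × b ≤ suc a

≈₁-refl : ∀ {a} → a ≈₁ a
≈₁-refl = n≤1+n _ , n≤1+n _

≈₁-sym : ∀ {a b} → a ≈₁ b → b ≈₁ a
≈₁-sym (a≤1+b , b≤1+a) = b≤1+a , a≤1+b

1+n≈₁n : ∀ n → suc n ≈₁ n
1+n≈₁n n = ≤-refl , m≤n⇒m≤1+n (n≤1+n n)

≈₁-window : ∀ {a c} → c ∸ 1 ≤ a → a ≤ c + 1 → a ≈₁ c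
≈₁-window {a} {c} c∸1≤a a≤c+1 =
  subst (a ≤_) (+-comm c 1) a≤c+1 , ≤-trans (m≤n+m∸n c 1) (s≤s c∸1≤a)

≈₁-clamp : ∀ {lo hi a} → lo ≤ suc a → a ≤ suc hi → a ≈₁ lo ⊔ (a ⊓ hi)
≈₁-clamp {lo} {hi} {a} lo≤1+a a≤1+hi =
  ≤-trans (⊓-glb (n≤1+n a) a≤1+hi) (s≤s (m≤n⊔m lo (a ⊓ hi))) ,
  ⊔-lub lo≤1+a (≤-trans (m⊓n≤m a hi) (n≤1+n a))

m∸n≤1+m∸1+n : ∀ m n → m ∸ n ≤ suc (m ∸ suc n)
m∸n≤1+m∸1+n zero    zero    = z≤n
m∸n≤1+m∸1+n zero    (suc n) = z≤n
m∸n≤1+m∸1+n (suc m) zero    = ≤-refl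
m∸n≤1+m∸1+n (suc m) (suc n) = m∸n≤1+m∸1+n m n

sumPow-monoˡ-≤ : ∀ k {a b} → a ≤ b → sumPow a k ≤ sumPow b k
sumPow-monoˡ-≤ zero    a≤b = z≤n
sumPow-monoˡ-≤ (suc p) a≤b =
  +-mono-≤ (sumPow-monoˡ-≤ p a≤b) (^-monoʳ-≤ (2 * suc p + 1) (∸-monoˡ-≤ 1 a≤b))

bound-monoʳ-< : ∀ k {a b} → a < b → bound k a < bound k b
bound-monoʳ-< k a<b = +-mono-<-≤ a<b (*-mono-≤ (<⇒≤ a<b) (sumPow-monoˡ-≤ k (<⇒≤ a<b)))

∣full++p∣ : ∀ m {n} (p : Subset n) → ∣ full {m} ++ p ∣ ≡ m + ∣ p ∣
∣full++p∣ zero    p = refl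
∣full++p∣ (suc m) p = cong suc (∣full++p∣ m p)

-- A block of level p packs the offsets, in [0, 2(p+1)], of the distances to the g landmarks
-- other than the nearest one, which is at distance p+1.
module Labels (g : ℕ) where

  Block : ℕ → Set
  Block zero    = ⊥
  Block (suc q) = Block q ⊎ Fin ((2 * suc q + 1) ^ g)

  Block↔Fin : ∀ q → Block q ↔ Fin (sumPow (suc g) q)
  Block↔Fin zero    = ↔-sym 0↔⊥
  Block↔Fin (suc q) = ↔-trans (Block↔Fin q ⊎-↔ ↔-refl) (↔-sym +↔⊎)

  Label : ℕ → Set
  Label k = Fin (suc g) ⊎ (Fin (suc g) × Block k)

  Label↔Fin : ∀ k → Label k ↔ Fin (bound k (suc g))
  Label↔Fin k =
    ↔-trans (↔-refl ⊎-↔ ↔-trans (↔-refl ×-↔ Block↔Fin k) (↔-sym *↔×)) (↔-sym +↔⊎)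

  level : ∀ {q} → Block q → ℕ
  level {suc q} (inj₁ b) = level b
  level {suc q} (inj₂ _) = q

  level< : ∀ {q} (b : Block q) → level b < q
  level< {suc q} (inj₁ b) = m<n⇒m<1+n (level< b)
  level< {suc q} (inj₂ _) = ≤-refl

  offset : ∀ {q} → Block q → Fin g → ℕ
  offset {suc q} (inj₁ b) = offset b
  offset {suc q} (inj₂ c) = toℕ ∘ finToFun c

  offset≤ : ∀ {q} (b : Block q) j → offset b j ≤ 2 * suc (level b)
  offset≤ {suc q} (inj₁ b)   = offset≤ b
  offset≤ {suc q} (inj₂ c) j = m<n+1⇒m≤n (2 * suc q) (toℕ<n (finToFun c j))

  block : ∀ {q} p → p < q → (o : Fin g → ℕ) → (∀ j → o j ≤ 2 * suc p) → Block q
  block {suc q} p p<q o o≤ with p ≟ q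
  ... | yes refl = inj₂ (funToFin (λ j → fromℕ< (m≤n⇒m<n+1 (o≤ j))))
  ... | no  p≢q  = inj₁ (block p (≤∧≢⇒< (≤-pred p<q) p≢q) o o≤)

  level-block : ∀ {q} p p<q o o≤ → level (block {q} p p<q o o≤) ≡ p
  level-block {suc q} p p<q o o≤ with p ≟ q
  ... | yes refl = refl
  ... | no  p≢q  = level-block p (≤∧≢⇒< (≤-pred p<q) p≢q) o o≤

  offset-block : ∀ {q} p p<q o o≤ j → offset (block {q} p p<q o o≤) j ≡ o j
  offset-block {suc q} p p<q o o≤ j with p ≟ q
  ... | yes refl = trans (cong toℕ (finToFun-funToFin _ j)) (toℕ-fromℕ< _)
  ... | no  p≢q  = offset-block p (≤∧≢⇒< (≤-pred p<q) p≢q) o o≤ j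

  funToFin-cong : ∀ {m l} {f f′ : Fin m → Fin l} → f ≗ f′ → funToFin f ≡ funToFin f′
  funToFin-cong {zero}  _ = refl
  funToFin-cong {suc m} h = cong₂ combine (h zero) (funToFin-cong (h ∘ suc))

  block-injective : ∀ {q} (b b′ : Block q) → level b ≡ level b′ → offset b ≗ offset b′ → b ≡ b′
  block-injective {suc q} (inj₁ b) (inj₁ b′) l o = cong inj₁ (block-injective b b′ l o)
  block-injective {suc q} (inj₁ b) (inj₂ _)  l _ = ⊥-elim (<-irrefl l (level< b))
  block-injective {suc q} (inj₂ _) (inj₁ b′) l _ = ⊥-elim (<-irrefl (sym l) (level< b′))
  block-injective {suc q} (inj₂ c) (inj₂ c′) _ o = cong inj₂ (begin
    c                         ≡⟨ funToFin-finToFin {g} c ⟨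
    funToFin (digits c)       ≡⟨ funToFin-cong (toℕ-injective ∘ o) ⟩
    funToFin (digits c′)      ≡⟨ funToFin-finToFin {g} c′ ⟩
    c′                        ∎)
    where
    open ≡-Reasoning
    digits : Fin ((2 * suc q + 1) ^ g) → Fin g → Fin (2 * suc q + 1)
    digits = finToFun

record Enumeration {n : ℕ} (W : Subset n) (m : ℕ) : Set where
  field
    element       : Fin m → Fin n
    element∈      : ∀ i → element i ∈ W
    index         : ∀ v → v ∈ W → Fin m
    element-index : ∀ v (v∈W : v ∈ W) → element (index v v∈W) ≡ v

enumerate : ∀ {n} (W : Subset n) → Enumeration W ∣ W ∣
enumerate [] = record
  { element = λ () ; element∈ = λ () ; index = λ _ () ; element-index = λ _ () }
enumerate (outside ∷ W) = record
  { element       = suc ∘ element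
  ; element∈      = there ∘ element∈
  ; index         = λ { (suc v) (there v∈W) → index v v∈W }
  ; element-index = λ { (suc v) (there v∈W) → cong suc (element-index v v∈W) }
  }
  where open Enumeration (enumerate W)
enumerate (inside ∷ W) = record
  { element       = λ { zero → zero ; (suc i) → suc (element i) }
  ; element∈      = λ { zero → here ; (suc i) → there (element∈ i) }
  ; index         = λ { zero _ → zero ; (suc v) (there v∈W) → suc (index v v∈W) }
  ; element-index = λ { zero here → refl ; (suc v) (there v∈W) → cong suc (element-index v v∈W) }
  }
  where open Enumeration (enumerate W)

module UpperBound {n : ℕ} (G : Graph n) (C : Connected G) (k : ℕ) {W : Subset n}
                  (R : Resolving G W) (K : KDominating G k W) where
  open Walks G
  open Distance G C

  resolving⇒dist-injective : ∀ {u v} → u ∉ W → v ∉ W →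
                             (∀ w → w ∈ W → dist u w ≡ dist v w) → u ≡ v
  resolving⇒dist-injective {u} {v} u∉W v∉W same with u ≟ᶠ v
  ... | yes u≡v = u≡v
  ... | no  u≢v with R u v u∉W v∉W u≢v
  ... | w , w∈W , d₁ , d₂ , D₁ , D₂ , d₁≢d₂ = ⊥-elim (d₁≢d₂ (begin
    d₁        ≡⟨ Dist-unique D₁ (dist-Dist u w) ⟩
    dist u w  ≡⟨ same w w∈W ⟩
    dist v w  ≡⟨ Dist-unique (dist-Dist v w) D₂ ⟩
    d₂        ∎))
    where open ≡-Reasoning

  module Labelling {g : ℕ} (E : Enumeration W (suc g)) where
    open Enumeration E
    open Labels g

    record Anchor (v : Fin n) : Set where
      constructor anchored
      field
        centre      : Fin (suc g)
        depth       : ℕ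
        centre-dist : dist v (element centre) ≡ suc depth
        depth<k     : depth < k

    anchor : ∀ {v} → v ∉ W → Anchor v
    anchor {v} v∉W with K v v∉W
    ... | w , w∈W , r = anchorAt (index w w∈W) (subst (Reach G k v) (sym (element-index w w∈W)) r)
      where
      anchorAt : ∀ i → Reach G k v (element i) → Anchor v
      anchorAt i r with dist v (element i) in eq
      ... | zero  = ⊥-elim (v∉W (subst (_∈ W) (sym (dist≡0⇒≡ eq)) (element∈ i)))
      ... | suc q = anchored i q eq (subst (_≤ k) eq (dist-≤ r))

    centre-lower : ∀ {v} (a : Anchor v) j →
                   dist (element (Anchor.centre a)) (element j) ∸ suc (Anchor.depth a)
                     ≤ dist v (element j)
    centre-lower {v} (anchored i q eq _) j = m≤n+o⇒m∸n≤o _ (suc q) (begin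
      dist (element i) (element j)                 ≤⟨ dist-triangle _ v _ ⟩
      dist (element i) v + dist v (element j)      ≡⟨ cong (_+ _) (trans (dist-sym _ v) eq) ⟩
      suc q + dist v (element j)                   ∎)
      where open ≤-Reasoning

    centre-upper : ∀ {v} (a : Anchor v) j →
                   dist v (element j) ≤ dist (element (Anchor.centre a)) (element j) + suc (Anchor.depth a)
    centre-upper {v} (anchored i q eq _) j = begin
      dist v (element j)                           ≤⟨ dist-triangle v (element i) _ ⟩
      dist v (element i) + dist (element i) (element j)  ≡⟨ cong (_+ _) eq ⟩
      suc q + dist (element i) (element j)         ≡⟨ +-comm (suc q) _ ⟩
      dist (element i) (element j) + suc q         ∎
      where open ≤-Reasoning

    offsets : ∀ {v} → Anchor v → Fin g → ℕ
    offsets {v} (anchored i q _ _) j =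
      dist v (element (punchIn i j)) ∸ (dist (element i) (element (punchIn i j)) ∸ suc q)

    offsets≤ : ∀ {v} (a : Anchor v) j → offsets a j ≤ 2 * suc (Anchor.depth a)
    offsets≤ a@(anchored i q _ _) j = ∸-window (suc q) (centre-upper a (punchIn i j))

    anchorLabel : ∀ {v} → Anchor v → Fin (suc g) × Block k
    anchorLabel a@(anchored i q _ q<k) = i , block q q<k (offsets a) (offsets≤ a)

    anchor-data≡⇒dist≡ : ∀ {u v} (a : Anchor u) (b : Anchor v) →
                   Anchor.centre a ≡ Anchor.centre b → Anchor.depth a ≡ Anchor.depth b →
                   offsets a ≗ offsets b → ∀ j → dist u (element j) ≡ dist v (element j)
    anchor-data≡⇒dist≡ {u} {v} a@(anchored i q du _) b@(anchored .i .q dv _) refl refl same j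
      with i ≟ᶠ j
    ... | yes refl = trans du (sym dv)
    ... | no  i≢j  = subst (λ x → dist u (element x) ≡ dist v (element x)) (punchIn-punchOut i≢j)
      (∸-cancelʳ-≡ (centre-lower a _) (centre-lower b _) (same (punchOut i≢j)))

    anchorLabel≡⇒dist≡ : ∀ {u v} (a : Anchor u) (b : Anchor v) → anchorLabel a ≡ anchorLabel b →
                            ∀ j → dist u (element j) ≡ dist v (element j)
    anchorLabel≡⇒dist≡ a@(anchored i q _ q<k) b@(anchored i′ q′ _ q′<k) eq =
      anchor-data≡⇒dist≡ a b (cong proj₁ eq) q≡q′ offsets≗
      where
      q≡q′ : q ≡ q′
      q≡q′ = trans (sym (level-block q q<k _ _))
                   (trans (cong (level ∘ proj₂) eq) (level-block q′ q′<k _ _))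
      offsets≗ : offsets a ≗ offsets b
      offsets≗ j = trans (sym (offset-block q q<k _ _ j))
                   (trans (cong (λ l → offset (proj₂ l) j) eq) (offset-block q′ q′<k _ _ j))

    classify : ∀ v → Dec (v ∈ W) → Label k
    classify v (yes v∈W) = inj₁ (index v v∈W)
    classify v (no  v∉W) = inj₂ (anchorLabel (anchor v∉W))

    classify-injective : ∀ {u v} u∈? v∈? → classify u u∈? ≡ classify v v∈? → u ≡ v
    classify-injective {u} {v} (yes u∈W) (yes v∈W) eq = begin
      u                          ≡⟨ element-index u u∈W ⟨
      element (index u u∈W)      ≡⟨ cong element (inj₁-injective eq) ⟩
      element (index v v∈W)      ≡⟨ element-index v v∈W ⟩
      v                          ∎
      where open ≡-Reasoning
    classify-injective {u} {v} (no u∉W) (no v∉W) eq = resolving⇒dist-injective u∉W v∉W λ w w∈W →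
      subst (λ x → dist u x ≡ dist v x) (element-index w w∈W)
            (anchorLabel≡⇒dist≡ (anchor u∉W) (anchor v∉W) (inj₂-injective eq) (index w w∈W))

    order≤bound : n ≤ bound k (suc g)
    order≤bound = injective⇒≤ {f = to ∘ label} λ {u} {v} eq →
      classify-injective (u ∈? W) (v ∈? W) (Injection.injective (↔⇒↣ (Label↔Fin k)) eq)
      where
      open Inverse (Label↔Fin k) using (to)
      label : Fin n → Label k
      label v = classify v (v ∈? W)

  order≤bound-∣W∣ : n ≤ bound k ∣ W ∣
  order≤bound-∣W∣ = fromEnumeration (enumerate W)
    where
    fromEnumeration : ∀ {γ} → Enumeration W γ → n ≤ bound k γ
    fromEnumeration {zero}  E = injective⇒≤ {f = ⊥-elim ∘ noVertex} λ {v} → ⊥-elim (noVertex v)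
      where
      open Enumeration E
      noVertex : Fin n → ⊥
      noVertex v with v ∈? W
      ... | yes v∈W = ¬Fin0 (index v v∈W)
      ... | no  v∉W = ¬Fin0 (index _ (proj₁ (proj₂ (K v v∉W))))
    fromEnumeration {suc g} E = Labelling.order≤bound E

module Construction (k′ g : ℕ) where
  open Labels g

  k : ℕ
  k = suc k′

  -- Landmarks are pairwise at distance D; as D ∸ k > k, the centre of a block vertex is its
  -- only coordinate ≤ k.
  D : ℕ
  D = 2 * k + 1

  k<D : k < D
  k<D = ≤-<-trans (m≤m+n k (k + 0)) (m<m+n (2 * k) z<s)

  D∸k≡1+k : D ∸ k ≡ suc k
  D∸k≡1+k = trans (cong (_∸ k) (D≡ k)) (m+n∸n≡m (suc k) k)
    where
    D≡ : ∀ k → 2 * k + 1 ≡ suc k + k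
    D≡ = solve-∀

  -- The intended distances to the landmarks; landmark-Dist shows they are the actual ones.
  Profile : Set
  Profile = Fin (suc g) → ℕ

  landmarkProfile : Fin (suc g) → Profile
  landmarkProfile i j with i ≟ᶠ j
  ... | yes _ = 0
  ... | no  _ = D

  landmarkProfile-self : ∀ i → landmarkProfile i i ≡ 0
  landmarkProfile-self i with i ≟ᶠ i
  ... | yes _   = refl
  ... | no  i≢i = ⊥-elim (i≢i refl)

  landmarkProfile-other : ∀ {i j} → i ≢ j → landmarkProfile i j ≡ D
  landmarkProfile-other {i} {j} i≢j with i ≟ᶠ j
  ... | yes i≡j = ⊥-elim (i≢j i≡j)
  ... | no  _   = refl

  blockProfile : Fin (suc g) → Block k → Profile
  blockProfile i b j with i ≟ᶠ j
  ... | yes _   = suc (level b)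
  ... | no  i≢j = D ∸ suc (level b) + offset b (punchOut i≢j)

  blockProfile-self : ∀ i b → blockProfile i b i ≡ suc (level b)
  blockProfile-self i b with i ≟ᶠ i
  ... | yes _   = refl
  ... | no  i≢i = ⊥-elim (i≢i refl)

  blockProfile-other : ∀ i b {j} (i≢j : i ≢ j) →
                       blockProfile i b j ≡ D ∸ suc (level b) + offset b (punchOut i≢j)
  blockProfile-other i b {j} i≢j with i ≟ᶠ j
  ... | yes i≡j = ⊥-elim (i≢j i≡j)
  ... | no  _   = cong (λ j′ → D ∸ suc (level b) + offset b j′) (punchOut-cong i refl)

  blockProfile-punchIn : ∀ i b j → blockProfile i b (punchIn i j) ≡ D ∸ suc (level b) + offset b j
  blockProfile-punchIn i b j = trans (blockProfile-other i b (≢-sym (punchInᵢ≢i i j)))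
    (cong (λ j′ → D ∸ suc (level b) + offset b j′) (punchOut-punchIn i))

  profile : Label k → Profile
  profile (inj₁ i)       = landmarkProfile i
  profile (inj₂ (i , b)) = blockProfile i b

  record BlockShaped (i : Fin (suc g)) (x : Profile) : Set where
    constructor shaped
    field
      centre-pos : 0 < x i
      centre≤k   : x i ≤ k
      lower      : ∀ j → i ≢ j → D ∸ x i ≤ x j
      upper      : ∀ j → i ≢ j → x j ≤ D + x i

  open BlockShaped

  blockProfile-shaped : ∀ i b → BlockShaped i (blockProfile i b)
  blockProfile-shaped i b = shaped
    (subst (0 <_) (sym (blockProfile-self i b)) z<s)
    (subst (_≤ k) (sym (blockProfile-self i b)) (level< b))
    lower′ upper′
    where
    p = suc (level b)
    p≤D : p ≤ D
    p≤D = <⇒≤ (≤-<-trans (level< b) k<D)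
    x = blockProfile i b
    lower′ : ∀ j → i ≢ j → D ∸ x i ≤ x j
    lower′ j i≢j rewrite blockProfile-self i b | blockProfile-other i b i≢j = m≤m+n (D ∸ p) _
    upper′ : ∀ j → i ≢ j → x j ≤ D + x i
    upper′ j i≢j rewrite blockProfile-self i b | blockProfile-other i b i≢j = begin
      D ∸ p + offset b (punchOut i≢j)   ≤⟨ +-monoʳ-≤ (D ∸ p) (offset≤ b (punchOut i≢j)) ⟩
      D ∸ p + 2 * p                     ≡⟨ +-assoc (D ∸ p) p (p + 0) ⟨
      D ∸ p + p + (p + 0)               ≡⟨ cong₂ _+_ (m∸n+n≡m p≤D) (+-identityʳ p) ⟩
      D + p                             ∎
      where open ≤-Reasoning

  shaped-far : ∀ {i x} → BlockShaped i x → ∀ j → i ≢ j → k < x j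
  shaped-far {i} {x} s j i≢j = begin-strict
    k          <⟨ n<1+n k ⟩
    suc k      ≡⟨ D∸k≡1+k ⟨
    D ∸ k      ≤⟨ ∸-monoʳ-≤ D (centre≤k s) ⟩
    D ∸ x i    ≤⟨ lower s j i≢j ⟩
    x j        ∎
    where open ≤-Reasoning

  shaped-pos : ∀ {i x} → BlockShaped i x → ∀ j → 0 < x j
  shaped-pos {i} s j with i ≟ᶠ j
  ... | yes refl = centre-pos s
  ... | no  i≢j  = ≤-<-trans z≤n (shaped-far s j i≢j)

  Realisable : Profile → Set
  Realisable x = Σ (Label k) λ c → profile c ≗ x

  realise : ∀ {i x} → BlockShaped i x → Realisable x
  realise {i} {x} s with x i in xi
  ... | zero  = ⊥-elim (<-irrefl (sym xi) (centre-pos s))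
  ... | suc q = inj₂ (i , b) , agrees
    where
    p = suc q
    o : Fin g → ℕ
    o j = x (punchIn i j) ∸ (D ∸ p)
    q<k : q < k
    q<k = subst (_≤ k) xi (centre≤k s)
    o≤ : ∀ j → o j ≤ 2 * p
    o≤ j = ∸-window {c = D} p (subst (λ y → x (punchIn i j) ≤ D + y) xi
                                     (upper s _ (≢-sym (punchInᵢ≢i i j))))
    b : Block k
    b = block q q<k o o≤
    level-b : level b ≡ q
    level-b = level-block q q<k o o≤
    agrees : profile (inj₂ (i , b)) ≗ x
    agrees j with i ≟ᶠ j
    ... | yes refl = trans (cong suc level-b) (sym xi)
    ... | no  i≢j  = begin
      D ∸ suc (level b) + offset b j′          ≡⟨ cong (λ l → D ∸ suc l + offset b j′) level-b ⟩
      D ∸ p + offset b j′                      ≡⟨ cong (D ∸ p +_) (offset-block q q<k o o≤ j′) ⟩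
      D ∸ p + (x (punchIn i j′) ∸ (D ∸ p))     ≡⟨ cong (λ l → D ∸ p + (x l ∸ (D ∸ p))) (punchIn-punchOut i≢j) ⟩
      D ∸ p + (x j ∸ (D ∸ p))                  ≡⟨ m+[n∸m]≡n (subst (λ y → D ∸ y ≤ x j) xi (lower s j i≢j)) ⟩
      x j                                      ∎
      where
      open ≡-Reasoning
      j′ = punchOut i≢j

  profile≡0⇒landmark : ∀ c j → profile c j ≡ 0 → c ≡ inj₁ j
  profile≡0⇒landmark (inj₁ i) j eq with i ≟ᶠ j
  ... | yes i≡j = cong inj₁ i≡j
  ... | no  _   = ⊥-elim (1+n≢0 eq)
  profile≡0⇒landmark (inj₂ (i , b)) j eq =
    ⊥-elim (<-irrefl (sym eq) (shaped-pos (blockProfile-shaped i b) j))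

  profile-injective : ∀ c c′ → profile c ≗ profile c′ → c ≡ c′
  profile-injective (inj₁ i) c′ eq =
    sym (profile≡0⇒landmark c′ i (trans (sym (eq i)) (landmarkProfile-self i)))
  profile-injective c (inj₁ i′) eq =
    profile≡0⇒landmark c i′ (trans (eq i′) (landmarkProfile-self i′))
  profile-injective (inj₂ (i , b)) (inj₂ (i′ , b′)) eq with i ≟ᶠ i′
  ... | no  i≢i′ = ⊥-elim (<⇒≱ (shaped-far (blockProfile-shaped i′ b′) i (≢-sym i≢i′))
                                (subst (_≤ k) (eq i) (centre≤k (blockProfile-shaped i b))))
  ... | yes refl = cong (λ b → inj₂ (i , b)) (block-injective b b′ same-level same-offset)
    where
    same-level : level b ≡ level b′
    same-level = suc-injective (trans (sym (blockProfile-self i b)) (trans (eq i) (blockProfile-self i b′)))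
    same-offset : offset b ≗ offset b′
    same-offset j = +-cancelˡ-≡ (D ∸ suc (level b)) _ _ (begin
      D ∸ suc (level b) + offset b j     ≡⟨ blockProfile-punchIn i b j ⟨
      blockProfile i b (punchIn i j)     ≡⟨ eq (punchIn i j) ⟩
      blockProfile i b′ (punchIn i j)    ≡⟨ blockProfile-punchIn i b′ j ⟩
      D ∸ suc (level b′) + offset b′ j   ≡⟨ cong (λ l → D ∸ suc l + offset b′ j) same-level ⟨
      D ∸ suc (level b) + offset b′ j    ∎)
      where open ≡-Reasoning

  infixl 6 _[_]≔_

  _[_]≔_ : Profile → Fin (suc g) → ℕ → Profile
  x [ a ]≔ v = updateAt x a (const v)

  ≔-same : ∀ x a v → (x [ a ]≔ v) a ≡ v
  ≔-same x a v = updateAt-updates a x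

  ≔-other : ∀ x {a l} v → a ≢ l → (x [ a ]≔ v) l ≡ x l
  ≔-other x {a} {l} v a≢l = updateAt-minimal l a x (≢-sym a≢l)

  infix 4 _∼_

  _∼_ : Profile → Profile → Set
  x ∼ y = ∀ l → x l ≈₁ y l

  ∼-sym : ∀ {x y} → x ∼ y → y ∼ x
  ∼-sym x∼y = ≈₁-sym ∘ x∼y

  ∼-≔ : ∀ {x} y a {v} → (∀ l → a ≢ l → x l ≈₁ y l) → x a ≈₁ v → x ∼ y [ a ]≔ v
  ∼-≔ {x} y a {v} elsewhere at-a l with a ≟ᶠ l
  ... | yes refl = subst (x a ≈₁_) (sym (≔-same y a v)) at-a
  ... | no  a≢l  = subst (x l ≈₁_) (sym (≔-other y v a≢l)) (elsewhere l a≢l)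

  StepTowards : Profile → Fin (suc g) → Set
  StepTowards x j = Σ (Label k) λ c → x ∼ profile c × suc (profile c j) ≡ x j

  step-via : ∀ {x y j} → Realisable y → x ∼ y → suc (y j) ≡ x j → StepTowards x j
  step-via {x} (c , c≗y) x∼y step =
    c , (λ l → subst (x l ≈₁_) (sym (c≗y l)) (x∼y l)) , trans (cong suc (c≗y _)) step

  landmark-step : ∀ {i j} → i ≢ j → StepTowards (landmarkProfile i) j
  landmark-step {i} {j} i≢j = step-via (realise (shaped y-pos y≤k lower′ upper′)) x∼y y-step
    where
    x  = landmarkProfile i
    x′ = x [ j ]≔ pred D
    y  = x′ [ i ]≔ 1
    yi : y i ≡ 1
    yi = ≔-same x′ i 1
    x′-window : ∀ l → i ≢ l → pred D ≤ x′ l × x′ l ≤ D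
    x′-window l i≢l with j ≟ᶠ l
    ... | yes refl rewrite ≔-same x j (pred D) = ≤-refl , n≤1+n _
    ... | no  j≢l  rewrite ≔-other x (pred D) j≢l | landmarkProfile-other i≢l = n≤1+n _ , ≤-refl
    y-pos : 0 < y i
    y-pos = subst (0 <_) (sym yi) z<s
    y≤k : y i ≤ k
    y≤k = subst (_≤ k) (sym yi) (s≤s z≤n)
    lower′ : ∀ l → i ≢ l → D ∸ y i ≤ y l
    lower′ l i≢l rewrite yi | ≔-other x′ 1 i≢l = proj₁ (x′-window l i≢l)
    upper′ : ∀ l → i ≢ l → y l ≤ D + y i
    upper′ l i≢l rewrite yi | ≔-other x′ 1 i≢l = ≤-trans (proj₂ (x′-window l i≢l)) (m≤m+n D 1)
    x∼y : x ∼ y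
    x∼y = ∼-≔ x′ i (λ l _ → ∼-≔ x j (λ _ _ → ≈₁-refl) xj≈₁ l)
              (subst (_≈₁ 1) (sym (landmarkProfile-self i)) (≈₁-sym (1+n≈₁n 0)))
      where
      xj≈₁ : x j ≈₁ pred D
      xj≈₁ = subst (_≈₁ pred D) (sym (landmarkProfile-other i≢j)) (1+n≈₁n (pred D))
    y-step : suc (y j) ≡ x j
    y-step = trans (cong suc (trans (≔-other x′ 1 i≢j) (≔-same x j (pred D))))
                   (sym (landmarkProfile-other i≢j))

  centre-step-from-1 : ∀ {i x} → BlockShaped i x → x i ≡ 1 → StepTowards x i
  centre-step-from-1 {i} {x} s xi =
    step-via (inj₁ i , λ _ → refl) x∼y (trans (cong suc (landmarkProfile-self i)) (sym xi))
    where
    x∼y : x ∼ landmarkProfile i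
    x∼y l with i ≟ᶠ l
    ... | yes refl = subst (_≈₁ 0) (sym xi) (1+n≈₁n 0)
    ... | no  i≢l  = ≈₁-window (subst (λ c → D ∸ c ≤ x l) xi (lower s l i≢l))
                               (subst (λ c → x l ≤ D + c) xi (upper s l i≢l))

  -- One step closer to the centre narrows the window by 1; clamping the other coordinates into
  -- it moves each of them by at most 1.
  centre-step-narrow : ∀ {i x} q → BlockShaped i x → x i ≡ suc (suc q) → StepTowards x i
  centre-step-narrow {i} {x} q s xi = step-via (realise (shaped y-pos y≤k lower′ upper′)) x∼y y-step
    where
    p = suc q
    clamp : ℕ → ℕ
    clamp a = D ∸ p ⊔ (a ⊓ (D + p))
    y = (clamp ∘ x) [ i ]≔ p
    yi : y i ≡ p
    yi = ≔-same (clamp ∘ x) i p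
    y-pos : 0 < y i
    y-pos = subst (0 <_) (sym yi) z<s
    y≤k : y i ≤ k
    y≤k = subst (_≤ k) (sym yi) (<⇒≤ (subst (_≤ k) xi (centre≤k s)))
    lower′ : ∀ l → i ≢ l → D ∸ y i ≤ y l
    lower′ l i≢l rewrite yi | ≔-other (clamp ∘ x) p i≢l = m≤m⊔n (D ∸ p) _
    upper′ : ∀ l → i ≢ l → y l ≤ D + y i
    upper′ l i≢l rewrite yi | ≔-other (clamp ∘ x) p i≢l =
      ⊔-lub (≤-trans (m∸n≤m D p) (m≤m+n D p)) (m⊓n≤n _ (D + p))
    x∼y : x ∼ y
    x∼y = ∼-≔ (clamp ∘ x) i (λ l i≢l → ≈₁-clamp (lo≤ l i≢l) (hi≤ l i≢l))
              (subst (_≈₁ p) (sym xi) (1+n≈₁n p))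
      where
      lo≤ : ∀ l → i ≢ l → D ∸ p ≤ suc (x l)
      lo≤ l i≢l =
        ≤-trans (m∸n≤1+m∸1+n D p) (s≤s (subst (λ c → D ∸ c ≤ x l) xi (lower s l i≢l)))
      hi≤ : ∀ l → i ≢ l → x l ≤ suc (D + p)
      hi≤ l i≢l = subst (x l ≤_) (trans (cong (D +_) xi) (+-suc D p)) (upper s l i≢l)
    y-step : suc (y i) ≡ x i
    y-step = trans (cong suc yi) (sym xi)

  centre-step : ∀ {i x} → BlockShaped i x → StepTowards x i
  centre-step {i} {x} s = by-centre (x i) refl
    where
    by-centre : ∀ p → x i ≡ p → StepTowards x i
    by-centre zero          xi = ⊥-elim (<-irrefl (sym xi) (centre-pos s))
    by-centre (suc zero)    xi = centre-step-from-1 s xi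
    by-centre (suc (suc q)) xi = centre-step-narrow q s xi

  shaped-≔ : ∀ {i x j v} → BlockShaped i x → i ≢ j → D ∸ x i ≤ v → v ≤ D + x i →
             BlockShaped i (x [ j ]≔ v)
  shaped-≔ {i} {x} {j} {v} s i≢j lo hi =
    shaped (subst (0 <_) (sym yi) (centre-pos s)) (subst (_≤ k) (sym yi) (centre≤k s)) lower′ upper′
    where
    y = x [ j ]≔ v
    yi : y i ≡ x i
    yi = ≔-other x v (≢-sym i≢j)
    lower′ : ∀ l → i ≢ l → D ∸ y i ≤ y l
    lower′ l i≢l with j ≟ᶠ l
    ... | yes refl rewrite yi | ≔-same x j v = lo
    ... | no  j≢l  rewrite yi | ≔-other x v j≢l = lower s l i≢l
    upper′ : ∀ l → i ≢ l → y l ≤ D + y i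
    upper′ l i≢l with j ≟ᶠ l
    ... | yes refl rewrite yi | ≔-same x j v = hi
    ... | no  j≢l  rewrite yi | ≔-other x v j≢l = upper s l i≢l

  shaped-widen : ∀ {i x} → BlockShaped i x → x i < k → BlockShaped i (x [ i ]≔ suc (x i))
  shaped-widen {i} {x} s xi<k =
    shaped (subst (0 <_) (sym yi) z<s) (subst (_≤ k) (sym yi) xi<k) lower′ upper′
    where
    y = x [ i ]≔ suc (x i)
    yi : y i ≡ suc (x i)
    yi = ≔-same x i (suc (x i))
    lower′ : ∀ l → i ≢ l → D ∸ y i ≤ y l
    lower′ l i≢l rewrite yi | ≔-other x (suc (x i)) i≢l =
      ≤-trans (∸-monoʳ-≤ D (n≤1+n (x i))) (lower s l i≢l)
    upper′ : ∀ l → i ≢ l → y l ≤ D + y i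
    upper′ l i≢l rewrite yi | ≔-other x (suc (x i)) i≢l =
      ≤-trans (upper s l i≢l) (+-monoʳ-≤ D (n≤1+n (x i)))

  widen-step : ∀ {i x j z} → BlockShaped i x → i ≢ j → x j ≡ suc z → x i < k → StepTowards x j
  widen-step {i} {x} {j} {z} s i≢j xj xi<k = step-via (realise (shaped-≔ s′ i≢j lo hi)) x∼y y-step
    where
    x′ = x [ i ]≔ suc (x i)
    s′ = shaped-widen s xi<k
    x′i : x′ i ≡ suc (x i)
    x′i = ≔-same x i (suc (x i))
    lo : D ∸ x′ i ≤ z
    lo rewrite x′i = begin
      D ∸ suc (x i)        ≡⟨ pred[m∸n]≡m∸[1+n] D (x i) ⟨
      pred (D ∸ x i)       ≤⟨ pred-mono-≤ (subst (D ∸ x i ≤_) xj (lower s j i≢j)) ⟩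
      z                    ∎
      where open ≤-Reasoning
    hi : z ≤ D + x′ i
    hi rewrite x′i = ≤-trans (n≤1+n z) (subst (_≤ D + suc (x i)) xj
                       (≤-trans (upper s j i≢j) (+-monoʳ-≤ D (n≤1+n (x i)))))
    x∼y : x ∼ x′ [ j ]≔ z
    x∼y = ∼-≔ x′ j (λ l _ → ∼-≔ x i (λ _ _ → ≈₁-refl) (≈₁-sym (1+n≈₁n (x i))) l)
              (subst (_≈₁ z) (sym xj) (1+n≈₁n z))
    y-step : suc ((x′ [ j ]≔ z) j) ≡ x j
    y-step = trans (cong suc (≔-same x′ j z)) (sym xj)

  slack-step : ∀ {i x j z} → BlockShaped i x → i ≢ j → x j ≡ suc z → D ∸ x i ≤ z → StepTowards x j
  slack-step {i} {x} {j} {z} s i≢j xj slack =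
    step-via (realise (shaped-≔ s i≢j slack hi))
             (∼-≔ x j (λ _ _ → ≈₁-refl) (subst (_≈₁ z) (sym xj) (1+n≈₁n z)))
             (trans (cong suc (≔-same x j z)) (sym xj))
    where
    hi : z ≤ D + x i
    hi = ≤-trans (n≤1+n z) (subst (_≤ D + x i) xj (upper s j i≢j))

  recentre-step : ∀ {i x j} → BlockShaped i x → i ≢ j → x i ≡ k → x j ≡ suc k → StepTowards x j
  recentre-step {i} {x} {j} s i≢j xi xj =
    step-via (realise (shaped y-pos y≤k lower′ upper′)) x∼y (trans (cong suc yj) (sym xj))
    where
    x′ = x [ i ]≔ suc k
    y  = x′ [ j ]≔ k
    yj : y j ≡ k
    yj = ≔-same x′ j k
    y-pos : 0 < y j
    y-pos = subst (0 <_) (sym yj) z<s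
    y≤k : y j ≤ k
    y≤k = ≤-reflexive yj
    lower′ : ∀ l → j ≢ l → D ∸ y j ≤ y l
    lower′ l j≢l rewrite yj | ≔-other x′ k j≢l | D∸k≡1+k with i ≟ᶠ l
    ... | yes refl rewrite ≔-same x i (suc k) = ≤-refl
    ... | no  i≢l  rewrite ≔-other x (suc k) i≢l =
      subst (_≤ x l) (trans (cong (D ∸_) xi) D∸k≡1+k) (lower s l i≢l)
    upper′ : ∀ l → j ≢ l → y l ≤ D + y j
    upper′ l j≢l rewrite yj | ≔-other x′ k j≢l with i ≟ᶠ l
    ... | yes refl rewrite ≔-same x i (suc k) = ≤-trans k<D (m≤m+n D k)
    ... | no  i≢l  rewrite ≔-other x (suc k) i≢l = subst (λ c → x l ≤ D + c) xi (upper s l i≢l)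
    x∼y : x ∼ y
    x∼y = ∼-≔ x′ j (λ l _ → ∼-≔ x i (λ _ _ → ≈₁-refl) xi≈₁ l) (subst (_≈₁ k) (sym xj) (1+n≈₁n k))
      where
      xi≈₁ : x i ≈₁ suc k
      xi≈₁ = subst (_≈₁ suc k) (sym xi) (≈₁-sym (1+n≈₁n k))

  -- Towards a non-centre landmark j: widen the window while the centre is below depth k;
  -- otherwise decrease x j inside the window, and once x j is on its lower edge D ∸ k = k + 1,
  -- make j the new centre.
  off-centre-step : ∀ {i x j z} → BlockShaped i x → i ≢ j → x j ≡ suc z → StepTowards x j
  off-centre-step {i} {x} {j} {z} s i≢j xj with x i <? k
  ... | yes xi<k = widen-step s i≢j xj xi<k
  ... | no  xi≮k with D ∸ x i <? x j
  ... | yes slack = slack-step s i≢j xj (≤-pred (subst (D ∸ x i <_) xj slack))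
  ... | no  tight = recentre-step s i≢j xi≡k (begin
    x j        ≡⟨ ≤-antisym (≮⇒≥ tight) (lower s j i≢j) ⟩
    D ∸ x i    ≡⟨ cong (D ∸_) xi≡k ⟩
    D ∸ k      ≡⟨ D∸k≡1+k ⟩
    suc k      ∎)
    where
    open ≡-Reasoning
    xi≡k : x i ≡ k
    xi≡k = ≤-antisym (centre≤k s) (≮⇒≥ xi≮k)

  shaped-step : ∀ {i x} → BlockShaped i x → ∀ j → 0 < x j → StepTowards x j
  shaped-step {i} s j pos with i ≟ᶠ j
  ... | yes refl = centre-step s
  ... | no  i≢j  = off-centre-step s i≢j (sym (suc-pred _ {{>-nonZero pos}}))

  step : ∀ c j → 0 < profile c j → StepTowards (profile c) j
  step (inj₁ i) j pos = landmark-step {i} λ { refl → <-irrefl (sym (landmarkProfile-self i)) pos }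
  step (inj₂ (i , b)) j pos = shaped-step (blockProfile-shaped i b) j pos

  N : ℕ
  N = bound k (suc g)

  open Inverse (Label↔Fin k) using (to; from; strictlyInverseˡ; strictlyInverseʳ)

  profileOf : Fin N → Profile
  profileOf = profile ∘ from

  profileOf-injective : ∀ {u v} → profileOf u ≗ profileOf v → u ≡ v
  profileOf-injective {u} {v} same = begin
    u              ≡⟨ strictlyInverseˡ u ⟨
    to (from u)    ≡⟨ cong to (profile-injective (from u) (from v) same) ⟩
    to (from v)    ≡⟨ strictlyInverseˡ v ⟩
    v              ∎
    where open ≡-Reasoning

  landmark : Fin (suc g) → Fin N
  landmark = to ∘ inj₁

  profileOf-landmark : ∀ j → profileOf (landmark j) j ≡ 0
  profileOf-landmark j =
    trans (cong (λ c → profile c j) (strictlyInverseʳ (inj₁ j))) (landmarkProfile-self j)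

  Adjacent : Fin N → Fin N → Set
  Adjacent u v = u ≢ v × profileOf u ∼ profileOf v

  Adjacent? : ∀ u v → Dec (Adjacent u v)
  Adjacent? u v = ¬? (u ≟ᶠ v) ×-dec all? λ l →
    (profileOf u l ≤? suc (profileOf v l)) ×-dec (profileOf v l ≤? suc (profileOf u l))

  Adjacent-sym : ∀ {u v} → Adjacent u v → Adjacent v u
  Adjacent-sym (u≢v , u∼v) = ≢-sym u≢v , ∼-sym u∼v

  graph : Graph N
  graph = record
    { adj    = λ u v → does (Adjacent? u v)
    ; sym    = λ u v → does-⇔ (mk⇔ Adjacent-sym Adjacent-sym) (Adjacent? u v) (Adjacent? v u)
    ; irrefl = λ u → dec-false (Adjacent? u u) λ (u≢u , _) → u≢u refl
    }

  adj⇒Adjacent : ∀ {u v} → adj graph u v ≡ true → Adjacent u v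
  adj⇒Adjacent {u} {v} eq =
    toWitness {a? = Adjacent? u v} (Equivalence.from T-≡ (trans (isYes≗does (Adjacent? u v)) eq))

  open Walks graph

  profile-lipschitz : ∀ d {u v} → Reach graph d u v → ∀ j → profileOf u j ≤ profileOf v j + d
  profile-lipschitz zero    refl     j = m≤m+n _ 0
  profile-lipschitz (suc d) (inj₁ r) j = ≤-trans (profile-lipschitz d r j) (+-monoʳ-≤ _ (n≤1+n d))
  profile-lipschitz (suc d) {u} {v} (inj₂ (w , u-w , r)) j = begin
    profileOf u j             ≤⟨ proj₁ (proj₂ (adj⇒Adjacent {u} {w} u-w) j) ⟩
    suc (profileOf w j)       ≤⟨ s≤s (profile-lipschitz d r j) ⟩
    suc (profileOf v j + d)   ≡⟨ +-suc _ d ⟨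
    profileOf v j + suc d     ∎
    where open ≤-Reasoning

  reach-landmark : ∀ j d u → profileOf u j ≡ d → Reach graph d u (landmark j)
  reach-landmark j zero    u eq =
    trans (sym (strictlyInverseˡ u)) (cong to (profile≡0⇒landmark (from u) j eq))
  reach-landmark j (suc d) u eq with step (from u) j (subst (0 <_) (sym eq) z<s)
  ... | c , u∼c , c-step =
    inj₂ (to c , dec-true (Adjacent? u (to c)) (u≢v , u∼v) , reach-landmark j d (to c) vj)
    where
    profileOf-to : profileOf (to c) ≗ profile c
    profileOf-to l = cong (λ c′ → profile c′ l) (strictlyInverseʳ c)
    u∼v : profileOf u ∼ profileOf (to c)
    u∼v l = subst (profileOf u l ≈₁_) (sym (profileOf-to l)) (u∼c l)
    vj : profileOf (to c) j ≡ d
    vj = suc-injective (trans (cong suc (profileOf-to j)) (trans c-step eq))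
    u≢v : u ≢ to c
    u≢v refl = 1+n≢n (trans (cong suc (profileOf-to j)) c-step)

  landmark-Dist : ∀ u j → Dist graph u (landmark j) (profileOf u j)
  landmark-Dist u j = reach-landmark j _ u refl , λ d d<p r → <⇒≱ d<p (begin
    profileOf u j                  ≤⟨ profile-lipschitz d r j ⟩
    profileOf (landmark j) j + d   ≡⟨ cong (_+ d) (profileOf-landmark j) ⟩
    d                              ∎)
    where open ≤-Reasoning

  connected : Connected graph
  connected u v = _ , Reach-trans (profileOf u zero) (reach-landmark zero _ u refl)
                                  (Reach-sym _ (reach-landmark zero _ v refl))

  blockCount : ℕ
  blockCount = suc g * sumPow (suc g) k

  landmarks : Subset N
  landmarks = full {suc g} ++ empty {blockCount}

  ∣landmarks∣ : ∣ landmarks ∣ ≡ suc g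
  ∣landmarks∣ = begin
    ∣ landmarks ∣                       ≡⟨ ∣full++p∣ (suc g) empty ⟩
    suc g + ∣ empty {blockCount} ∣      ≡⟨ cong (suc g +_) (∣⊥∣≡0 blockCount) ⟩
    suc g + 0                           ≡⟨ +-identityʳ (suc g) ⟩
    suc g                               ∎
    where open ≡-Reasoning

  landmark∈ : ∀ j → landmark j ∈ landmarks
  landmark∈ j = lookup⇒[]= (landmark j) landmarks
    (trans (lookup-++ˡ (full {suc g}) (empty {blockCount}) j) (lookup-replicate j inside))

  resolving : Resolving graph landmarks
  resolving u v _ _ u≢v
    with ¬∀⟶∃¬ (suc g) _ (λ j → profileOf u j ≟ profileOf v j) (u≢v ∘ profileOf-injective)
  ... | j , differ = landmark j , landmark∈ j , _ , _ , landmark-Dist u j , landmark-Dist v j , differ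

  dominating : KDominating graph k landmarks
  dominating v v∉ = by-label (from v) refl
    where
    by-label : ∀ c → from v ≡ c → ∃[ w ] (w ∈ landmarks × Reach graph k v w)
    by-label (inj₁ j) eq =
      ⊥-elim (v∉ (subst (_∈ landmarks) (trans (cong to (sym eq)) (strictlyInverseˡ v)) (landmark∈ j)))
    by-label (inj₂ (i , b)) eq = landmark i , landmark∈ i , Reach-mono near (reach-landmark i _ v refl)
      where
      near : profileOf v i ≤ k
      near = subst (λ c → profile c i ≤ k) (sym eq) (centre≤k (blockProfile-shaped i b))

  minimal : ∀ W → Resolving graph W → KDominating graph k W → suc g ≤ ∣ W ∣
  minimal W R K = ≮⇒≥ λ ∣W∣<γ →
    <⇒≱ (bound-monoʳ-< k ∣W∣<γ) (UpperBound.order≤bound-∣W∣ graph connected k R K)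

  γʳₖ≡ : GammaRK≡ graph k (suc g)
  γʳₖ≡ = (landmarks , ∣landmarks∣ , resolving , dominating) , minimal

order≤bound : ∀ {n} (G : Graph n) → Connected G → ∀ k γ → GammaRK≡ G k γ → n ≤ bound k γ
order≤bound G C k γ ((W , ∣W∣≡γ , R , K) , _) =
  subst (λ γ → _ ≤ bound k γ) ∣W∣≡γ (UpperBound.order≤bound-∣W∣ G C k R K)

extremal : ∀ k′ g → ∃[ n ] ∃[ G ]
  (Connected {n} G × GammaRK≡ G (suc k′) (suc g) × n ≡ bound (suc k′) (suc g))
extremal k′ g = N , graph , connected , γʳₖ≡ , refl
  where open Construction k′ g

theorem5p1 : ∀ (k γ : ℕ) → 1 ≤ k → 1 ≤ γ →
    (∀ (n : ℕ) (G : Graph n) → Connected G → GammaRK≡ G k γ → n ≤ bound k γ)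
    × (∃[ n ] ∃[ G ] (Connected {n} G × GammaRK≡ G k γ × n ≡ bound k γ))
theorem5p1 (suc k′) (suc g) _ _ = (λ n G C → order≤bound G C (suc k′) (suc g)) , extremal k′ g
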